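{- Let $d\ge 1$ and let $n$ be a positive integer having no prime divisor less than $2^d$. Then $n^{d-1}$ queens can be placed on $\mathbb{Z}_n^d$ with no two in conflict.
   Context: A queen on $\mathbb{Z}_n^d$ (coordinates modulo $n$) can move any number of times by a vector $\mathbf{x}\in\{ -1,0,1\}^d\setminus\{\mathbf{0}\}$. Queens occupy distinct fields, and two queens on fields $\mathbf{a}\ne\mathbf{b}$ are in conflict if $\mathbf{b}-\mathbf{a}=k\mathbf{x}$ in $\mathbb{Z}_n^d$ for some integer $k$ and some nonzero $\mathbf{x}\in\{ -1,0,1\}^d$. -}

module Defs where

open import Data.Nat as ℕ using (ℕ; _^_; _≤_)
open import Data.Nat.Divisibility as ℕD using ()
open import Data.Nat.Primality using (Prime)
open import Data.Integer as ℤ using (ℤ; +_; -_; 0ℤ; 1ℤ; -1ℤ)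
open import Data.Integer.Divisibility using () renaming (_∣_ to _∣ℤ_)
open import Data.Fin using (Fin; toℕ)
open import Data.Product using (Σ; ∃; _×_; proj₁)
open import Relation.Binary.PropositionalEquality using (_≡_; _≢_)
open import Relation.Nullary using (¬_)

Field : ℕ → ℕ → Set
Field n d = Fin d → Fin n

data Step : Set where
  minus zero plus : Step

stepℤ : Step → ℤ
stepℤ minus = -1ℤ
stepℤ zero  = 0ℤ
stepℤ plus  = 1ℤ

Direction : ℕ → Set
Direction d = Σ (Fin d → Step) λ x → ¬ (∀ i → x i ≡ zero)

infix 4 _≡[mod_]_
_≡[mod_]_ : ℤ → ℕ → ℤ → Set
a ≡[mod n ] b = (+ n) ∣ℤ (a ℤ.- b)

Conflict : ∀ {n d} → Field n d → Field n d → Set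
Conflict {n} {d} a b =
  ∃ λ (k : ℤ) → ∃ λ (x : Direction d) →
    ∀ i → ((+ toℕ (b i)) ℤ.- (+ toℕ (a i))) ≡[mod n ] (k ℤ.* stepℤ (proj₁ x i))

NoPrimeDivisorBelow : ℕ → ℕ → Set
NoPrimeDivisorBelow m n = ∀ p → Prime p → p ℕD.∣ n → m ≤ p

NonAttacking : ∀ {n d q} → (Fin q → Field n d) → Set
NonAttacking {q = q} Q =
  (∀ i j → i ≢ j → Q i ≢ Q j) × (∀ i j → i ≢ j → ¬ Conflict (Q i) (Q j))

-- The queens are the points u of ℤ_n^d on the hyperplane u₀ + 2 u₁ + 4 u₂ + ⋯ + 2^(d-1) u_(d-1) ≡ 0
-- (mod n); the last d - 1 coordinates are free and determine u₀, giving n^(d-1) distinct queens.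
-- If u and v = u + k x (mod n) both lie on the hyperplane, then n divides k H with
-- H = x₀ + 2 x₁ + ⋯ + 2^(d-1) x_(d-1). Since x is a nonzero vector with entries in {-1,0,1},
-- H ≠ 0 and |H| < 2^d, so H is coprime to n (whose prime factors are all ≥ 2^d); hence n ∣ k and v = u.
module Submission where

open import Defs
open import Data.Nat using (ℕ; _^_; _≤_; _∸_; _<_)
open import Data.Fin using (Fin)
open import Data.Product using (Σ)

import Data.Nat as ℕ
open import Data.Nat using (zero; suc; z≤n; s≤s; NonZero; NonTrivial; >-nonZero)
open import Data.Nat.Properties
  using (≤-refl; ≤-total; ≤-antisym; ≤-trans; ≤-<-trans; <⇒≤; <⇒≱; >⇒≢; n≢0⇒n>0; m∸n≤m; m∸n≡0⇒m≤n;
         m≤m*n; *-suc; *-comm; *-zeroʳ; +-monoˡ-≤; *-monoʳ-≤; module ≤-Reasoning)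
open import Data.Nat.Divisibility using (_∣_; _∣?_; ∣⇒≤; >⇒∤; 0∣⇒≡0)
open import Data.Nat.Divisibility.Core using (hasNonTrivialDivisor)
open import Data.Nat.Coprimality using (Coprime; coprime-divisor)
open import Data.Nat.Primality using (_Rough_; 0-rough; 1-rough; 2-rough; ∤⇒rough-suc; rough∧∣⇒prime)
open import Data.Integer as ℤ using (ℤ; +_; 0ℤ; ∣_∣)
import Data.Integer.Properties as ℤ
import Data.Integer.Divisibility.Signed as Signed
open import Data.Integer.DivMod using (_%ℕ_; _/ℕ_; n%ℕd<d; a≡a%ℕn+[a/ℕn]*n)
open import Data.Integer.Tactic.RingSolver using (solve-∀)
open import Algebra.Properties.AbelianGroup ℤ.+-0-abelianGroup using (inverseˡ-unique)
open import Data.Fin using (zero; suc; toℕ; fromℕ<; combine; finToFun; funToFin)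
open import Data.Fin.Properties using (toℕ-injective; toℕ<n; toℕ-fromℕ<; funToFin-finToFin)
open import Data.Product using (_,_)
open import Data.Sum using (inj₁; inj₂)
open import Function using (_∘_)
open import Relation.Nullary using (¬_; yes; no; contradiction)
open import Relation.Binary.Bundles using (Setoid)
open import Relation.Binary.Structures using (IsEquivalence)
import Relation.Binary.Reasoning.Setoid as SetoidReasoning
open import Relation.Binary.PropositionalEquality
  using (_≡_; _≢_; _≗_; refl; sym; trans; cong; cong₂; cong-app; subst; module ≡-Reasoning)

funToFin-cong : ∀ {m n} {f g : Fin m → Fin n} → f ≗ g → funToFin f ≡ funToFin g
funToFin-cong {zero}  f≗g = refl
funToFin-cong {suc m} f≗g = cong₂ combine (f≗g zero) (funToFin-cong (f≗g ∘ suc))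

finToFun-injective : ∀ {m n} {i j : Fin (m ^ n)} → finToFun i ≗ finToFun j → i ≡ j
finToFun-injective {m} {n} {i} {j} eq = begin
  i                             ≡⟨ funToFin-finToFin {n} {m} i ⟨
  funToFin (finToFun {m} {n} i) ≡⟨ funToFin-cong {n} {m} eq ⟩
  funToFin (finToFun {m} {n} j) ≡⟨ funToFin-finToFin {n} {m} j ⟩
  j                             ∎
  where open ≡-Reasoning

-- A record, unlike `_≡[mod_]_`, lets Agda infer a and b from a proof of a ≈ b ⟨mod n ⟩.
infix 4 _≈_⟨mod_⟩
record _≈_⟨mod_⟩ (a b : ℤ) (n : ℕ) : Set where
  constructor ⟨_⟩
  field
    divides-difference : + n Signed.∣ a ℤ.- b

≡mod⇒≈ : ∀ {n a b} → a ≡[mod n ] b → a ≈ b ⟨mod n ⟩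
≡mod⇒≈ p = ⟨ Signed.∣ᵤ⇒∣ p ⟩

module _ {n : ℕ} where

  private
    by : ∀ {a b e} → a ℤ.- b ≡ e → + n Signed.∣ e → a ≈ b ⟨mod n ⟩
    by eq n∣e = ⟨ subst (+ n Signed.∣_) (sym eq) n∣e ⟩

  ≈mod-refl : ∀ {a} → a ≈ a ⟨mod n ⟩
  ≈mod-refl {a} = ⟨ subst (+ n Signed.∣_) (sym (ℤ.+-inverseʳ a)) (Signed.divides 0ℤ refl) ⟩

  ≈mod-sym : ∀ {a b} → a ≈ b ⟨mod n ⟩ → b ≈ a ⟨mod n ⟩
  ≈mod-sym {a} {b} ⟨ p ⟩ = by (identity a b) (Signed.∣m⇒∣-m p)
    where
    identity : ∀ a b → b ℤ.- a ≡ ℤ.- (a ℤ.- b)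
    identity = solve-∀

  ≈mod-trans : ∀ {a b c} → a ≈ b ⟨mod n ⟩ → b ≈ c ⟨mod n ⟩ → a ≈ c ⟨mod n ⟩
  ≈mod-trans {a} {b} {c} ⟨ p ⟩ ⟨ q ⟩ = ⟨ subst (+ n Signed.∣_) (ℤ.+-minus-telescope a b c) (Signed.∣m∣n⇒∣m+n p q) ⟩

  ≈mod-+ : ∀ {a b c d} → a ≈ b ⟨mod n ⟩ → c ≈ d ⟨mod n ⟩ → a ℤ.+ c ≈ b ℤ.+ d ⟨mod n ⟩
  ≈mod-+ {a} {b} {c} {d} ⟨ p ⟩ ⟨ q ⟩ = by (identity a b c d) (Signed.∣m∣n⇒∣m+n p q)
    where
    identity : ∀ a b c d → (a ℤ.+ c) ℤ.- (b ℤ.+ d) ≡ (a ℤ.- b) ℤ.+ (c ℤ.- d)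
    identity = solve-∀

  ≈mod-- : ∀ {a b c d} → a ≈ b ⟨mod n ⟩ → c ≈ d ⟨mod n ⟩ → a ℤ.- c ≈ b ℤ.- d ⟨mod n ⟩
  ≈mod-- {a} {b} {c} {d} ⟨ p ⟩ ⟨ q ⟩ = by (identity a b c d) (Signed.∣m∣n⇒∣m-n p q)
    where
    identity : ∀ a b c d → (a ℤ.- c) ℤ.- (b ℤ.- d) ≡ (a ℤ.- b) ℤ.- (c ℤ.- d)
    identity = solve-∀

  ≈mod-*ˡ : ∀ k {a b} → a ≈ b ⟨mod n ⟩ → k ℤ.* a ≈ k ℤ.* b ⟨mod n ⟩
  ≈mod-*ˡ k {a} {b} ⟨ p ⟩ = by (identity k a b) (Signed.∣n⇒∣m*n k p)
    where
    identity : ∀ k a b → k ℤ.* a ℤ.- k ℤ.* b ≡ k ℤ.* (a ℤ.- b)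
    identity = solve-∀

  ≈mod-*ʳ : ∀ k {a b} → a ≈ b ⟨mod n ⟩ → a ℤ.* k ≈ b ℤ.* k ⟨mod n ⟩
  ≈mod-*ʳ k {a} {b} ⟨ p ⟩ = by (identity k a b) (Signed.∣m⇒∣m*n k p)
    where
    identity : ∀ k a b → a ℤ.* k ℤ.- b ℤ.* k ≡ (a ℤ.- b) ℤ.* k
    identity = solve-∀

  ≈mod-isEquivalence : IsEquivalence _≈_⟨mod n ⟩
  ≈mod-isEquivalence = record
    { refl = ≈mod-refl ; sym = ≈mod-sym ; trans = ≈mod-trans }

  ≈mod-0⇒∣ : ∀ {a} → a ≈ 0ℤ ⟨mod n ⟩ → n ∣ ∣ a ∣
  ≈mod-0⇒∣ {a} ⟨ p ⟩ = subst (n ∣_) (cong ∣_∣ (ℤ.+-identityʳ a)) (Signed.∣⇒∣ᵤ p)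

  ∣⇒≈mod-0 : ∀ {a} → n ∣ ∣ a ∣ → a ≈ 0ℤ ⟨mod n ⟩
  ∣⇒≈mod-0 {a} p = ⟨ subst (+ n Signed.∣_) (sym (ℤ.+-identityʳ a)) (Signed.∣ᵤ⇒∣ p) ⟩

  -≈0⇒≈ : ∀ {a b} → a ℤ.- b ≈ 0ℤ ⟨mod n ⟩ → a ≈ b ⟨mod n ⟩
  -≈0⇒≈ {a} {b} ⟨ p ⟩ = ⟨ subst (+ n Signed.∣_) (ℤ.+-identityʳ (a ℤ.- b)) p ⟩

≈mod-setoid : ℕ → Setoid _ _
≈mod-setoid n = record { isEquivalence = ≈mod-isEquivalence {n} }

multiple<⇒≡0 : ∀ {m n} → n < m → m ∣ n → n ≡ 0
multiple<⇒≡0 {n = zero}  _   _   = refl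
multiple<⇒≡0 {n = suc _} n<m m∣n = contradiction m∣n (>⇒∤ n<m)

≤-≈mod⇒≡ : ∀ {n x y} → x ≤ y → y < n → + x ≈ + y ⟨mod n ⟩ → x ≡ y
≤-≈mod⇒≡ {n} {x} {y} x≤y y<n ⟨ x≡y ⟩ = ≤-antisym x≤y (m∸n≡0⇒m≤n (multiple<⇒≡0 y∸x<n n∣y∸x))
  where
  y∸x<n : y ∸ x < n
  y∸x<n = ≤-<-trans (m∸n≤m y x) y<n
  n∣y∸x : n ∣ y ∸ x
  n∣y∸x = subst (n ∣_) (trans (cong ∣_∣ (ℤ.m-n≡m⊖n x y)) (ℤ.∣⊖∣-≤ x≤y)) (Signed.∣⇒∣ᵤ x≡y)

toℕ-cancel-≈mod : ∀ {n} {a b : Fin n} → + toℕ a ≈ + toℕ b ⟨mod n ⟩ → a ≡ b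
toℕ-cancel-≈mod {a = a} {b} a≡b with ≤-total (toℕ a) (toℕ b)
... | inj₁ a≤b = toℕ-injective (≤-≈mod⇒≡ a≤b (toℕ<n b) a≡b)
... | inj₂ b≤a = toℕ-injective (sym (≤-≈mod⇒≡ b≤a (toℕ<n a) (≈mod-sym a≡b)))

residue : ∀ n .{{_ : NonZero n}} → ℤ → Fin n
residue n z = fromℕ< (n%ℕd<d z n)

residue-≈mod : ∀ n .{{_ : NonZero n}} z → + toℕ (residue n z) ≈ z ⟨mod n ⟩
residue-≈mod n z = ⟨ Signed.divides (ℤ.- q) (begin
  + toℕ (residue n z) ℤ.- z       ≡⟨ cong (λ r → + r ℤ.- z) (toℕ-fromℕ< (n%ℕd<d z n)) ⟩
  + r ℤ.- z                       ≡⟨ cong (λ w → + r ℤ.- w) (a≡a%ℕn+[a/ℕn]*n z n) ⟩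
  + r ℤ.- (+ r ℤ.+ q ℤ.* + n)     ≡⟨ identity (+ r) q (+ n) ⟩
  ℤ.- q ℤ.* + n                   ∎) ⟩
  where
  open ≡-Reasoning
  r = z %ℕ n
  q = z /ℕ n
  identity : ∀ r q n → r ℤ.- (r ℤ.+ q ℤ.* n) ≡ ℤ.- q ℤ.* n
  identity = solve-∀

horner : ℤ → ∀ {d} → (Fin d → ℤ) → ℤ
horner c {zero}  v = 0ℤ
horner c {suc d} v = v zero ℤ.+ c ℤ.* horner c (v ∘ suc)

horner-- : ∀ c {d} (u v : Fin d → ℤ) → horner c (λ t → u t ℤ.- v t) ≡ horner c u ℤ.- horner c v
horner-- c {zero}  u v = refl
horner-- c {suc d} u v = begin
  (u zero ℤ.- v zero) ℤ.+ c ℤ.* horner c (λ t → u (suc t) ℤ.- v (suc t))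
    ≡⟨ cong (λ h → (u zero ℤ.- v zero) ℤ.+ c ℤ.* h) (horner-- c (u ∘ suc) (v ∘ suc)) ⟩
  (u zero ℤ.- v zero) ℤ.+ c ℤ.* (horner c (u ∘ suc) ℤ.- horner c (v ∘ suc))
    ≡⟨ identity (u zero) (v zero) c (horner c (u ∘ suc)) (horner c (v ∘ suc)) ⟩
  horner c u ℤ.- horner c v ∎
  where
  open ≡-Reasoning
  identity : ∀ a b c x y → (a ℤ.- b) ℤ.+ c ℤ.* (x ℤ.- y) ≡ (a ℤ.+ c ℤ.* x) ℤ.- (b ℤ.+ c ℤ.* y)
  identity = solve-∀

horner-* : ∀ c {d} k (v : Fin d → ℤ) → horner c (λ t → k ℤ.* v t) ≡ k ℤ.* horner c v
horner-* c {zero}  k v = sym (ℤ.*-zeroʳ k)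
horner-* c {suc d} k v = begin
  k ℤ.* v zero ℤ.+ c ℤ.* horner c (λ t → k ℤ.* v (suc t))
    ≡⟨ cong (λ h → k ℤ.* v zero ℤ.+ c ℤ.* h) (horner-* c k (v ∘ suc)) ⟩
  k ℤ.* v zero ℤ.+ c ℤ.* (k ℤ.* horner c (v ∘ suc))
    ≡⟨ identity k (v zero) c (horner c (v ∘ suc)) ⟩
  k ℤ.* horner c v ∎
  where
  open ≡-Reasoning
  identity : ∀ k a c x → k ℤ.* a ℤ.+ c ℤ.* (k ℤ.* x) ≡ k ℤ.* (a ℤ.+ c ℤ.* x)
  identity = solve-∀

horner-cong : ∀ c {n d} {u v : Fin d → ℤ} → (∀ t → u t ≈ v t ⟨mod n ⟩) → horner c u ≈ horner c v ⟨mod n ⟩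
horner-cong c {d = zero}  u≈v = ≈mod-refl
horner-cong c {d = suc d} u≈v = ≈mod-+ (u≈v zero) (≈mod-*ˡ c (horner-cong c (u≈v ∘ suc)))

∣stepℤ∣≤1 : ∀ s → ∣ stepℤ s ∣ ≤ 1
∣stepℤ∣≤1 minus = s≤s z≤n
∣stepℤ∣≤1 zero  = z≤n
∣stepℤ∣≤1 plus  = s≤s z≤n

∣stepℤ∣≡0⇒≡zero : ∀ s → ∣ stepℤ s ∣ ≡ 0 → s ≡ zero
∣stepℤ∣≡0⇒≡zero zero _ = refl

≤1∧≡≥2*⇒≡0 : ∀ {σ γ η} → 2 ≤ γ → σ ≤ 1 → σ ≡ γ ℕ.* η → η ≡ 0
≤1∧≡≥2*⇒≡0 {η = zero}  _   _   _    = refl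
≤1∧≡≥2*⇒≡0 {γ = γ} {suc η} 2≤γ σ≤1 refl = contradiction (≤-trans 2≤γ (m≤m*n γ (suc η))) (<⇒≱ (s≤s σ≤1))

module _ {c : ℤ} (2≤∣c∣ : 2 ≤ ∣ c ∣) where

  horner-steps-< : ∀ {d} (x : Fin d → Step) → ∣ horner c (stepℤ ∘ x) ∣ < ∣ c ∣ ^ d
  horner-steps-< {zero}  x = s≤s z≤n
  horner-steps-< {suc d} x = begin-strict
    ∣ s ℤ.+ c ℤ.* h ∣     ≤⟨ ℤ.∣i+j∣≤∣i∣+∣j∣ s (c ℤ.* h) ⟩
    σ ℕ.+ ∣ c ℤ.* h ∣     ≡⟨ cong (σ ℕ.+_) (ℤ.abs-* c h) ⟩
    σ ℕ.+ γ ℕ.* η         <⟨ s≤s (+-monoˡ-≤ (γ ℕ.* η) (∣stepℤ∣≤1 (x zero))) ⟩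
    2 ℕ.+ γ ℕ.* η         ≤⟨ +-monoˡ-≤ (γ ℕ.* η) 2≤∣c∣ ⟩
    γ ℕ.+ γ ℕ.* η         ≡⟨ *-suc γ η ⟨
    γ ℕ.* suc η           ≤⟨ *-monoʳ-≤ γ (horner-steps-< (x ∘ suc)) ⟩
    γ ℕ.* γ ^ d           ∎
    where
    open ≤-Reasoning
    s = stepℤ (x zero)
    h = horner c (stepℤ ∘ x ∘ suc)
    σ = ∣ s ∣
    γ = ∣ c ∣
    η = ∣ h ∣

  horner-steps-≡0 : ∀ {d} (x : Fin d → Step) → horner c (stepℤ ∘ x) ≡ 0ℤ → ∀ t → x t ≡ zero
  horner-steps-≡0 {suc d} x s+ch≡0 = λ where
      zero    → ∣stepℤ∣≡0⇒≡zero (x zero) ∣s∣≡0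
      (suc t) → horner-steps-≡0 (x ∘ suc) (ℤ.∣i∣≡0⇒i≡0 ∣h∣≡0) t
    where
    s = stepℤ (x zero)
    h = horner c (stepℤ ∘ x ∘ suc)
    ∣s∣≡∣c∣*∣h∣ : ∣ s ∣ ≡ ∣ c ∣ ℕ.* ∣ h ∣
    ∣s∣≡∣c∣*∣h∣ = trans (cong ∣_∣ (inverseˡ-unique s (c ℤ.* h) s+ch≡0))
                       (trans (ℤ.∣-i∣≡∣i∣ (c ℤ.* h)) (ℤ.abs-* c h))
    ∣h∣≡0 : ∣ h ∣ ≡ 0
    ∣h∣≡0 = ≤1∧≡≥2*⇒≡0 2≤∣c∣ (∣stepℤ∣≤1 (x zero)) ∣s∣≡∣c∣*∣h∣
    ∣s∣≡0 : ∣ s ∣ ≡ 0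
    ∣s∣≡0 = trans ∣s∣≡∣c∣*∣h∣ (trans (cong (∣ c ∣ ℕ.*_) ∣h∣≡0) (*-zeroʳ ∣ c ∣))

rough-suc : ∀ {m n p} .{{_ : NonTrivial p}} → NoPrimeDivisorBelow m n → p < m → p Rough n → suc p Rough n
rough-suc {n = n} {p} noSmallPrimes p<m p-rough with p ∣? n
... | no  p∤n = ∤⇒rough-suc p∤n p-rough
... | yes p∣n = contradiction (noSmallPrimes p (rough∧∣⇒prime p-rough p∣n) p∣n) (<⇒≱ p<m)

noPrimeDivisorBelow⇒rough : ∀ {m n} → NoPrimeDivisorBelow m n → m Rough n
noPrimeDivisorBelow⇒rough {m} {n} noSmallPrimes = rough m ≤-refl
  where
  rough : ∀ k → k ≤ m → k Rough n
  rough 0 _ = 0-rough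
  rough 1 _ = 1-rough
  rough 2 _ = 2-rough
  rough (suc p@(suc (suc _))) p<m = rough-suc noSmallPrimes p<m (rough p (<⇒≤ p<m))

rough⇒coprime : ∀ {m n h} → m Rough n → 0 < h → h < m → Coprime n h
rough⇒coprime _ 0<h _ {0} (_ , 0∣h) = contradiction (0∣⇒≡0 0∣h) (>⇒≢ 0<h)
rough⇒coprime _ _ _ {1} _ = refl
rough⇒coprime rough 0<h h<m {suc (suc _)} (g∣n , g∣h) =
  contradiction (hasNonTrivialDivisor (≤-<-trans (∣⇒≤ {{>-nonZero 0<h}} g∣h) h<m) g∣n) rough

rough-*≈0⇒≈0 : ∀ {m n k h} → m Rough n → 0 < ∣ h ∣ → ∣ h ∣ < m → k ℤ.* h ≈ 0ℤ ⟨mod n ⟩ → k ≈ 0ℤ ⟨mod n ⟩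
rough-*≈0⇒≈0 {n = n} {k} {h} rough 0<∣h∣ ∣h∣<m kh≈0 =
  ∣⇒≈mod-0 (coprime-divisor (rough⇒coprime rough 0<∣h∣ ∣h∣<m) n∣∣h∣*∣k∣)
  where
  n∣∣h∣*∣k∣ : n ∣ ∣ h ∣ ℕ.* ∣ k ∣
  n∣∣h∣*∣k∣ = subst (n ∣_) (trans (ℤ.abs-* k h) (*-comm ∣ k ∣ ∣ h ∣)) (≈mod-0⇒∣ kh≈0)

coords : ∀ {n d} → Field n d → Fin d → ℤ
coords u t = + toℕ (u t)

OnHyperplane : ∀ {n d} → ℤ → Field n d → Set
OnHyperplane {n} c u = horner c (coords u) ≈ 0ℤ ⟨mod n ⟩

onHyperplane-conflict⇒≗ : ∀ c {n d} {u v : Field n d} → 2 ≤ ∣ c ∣ → (∣ c ∣ ^ d) Rough n →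
  OnHyperplane c u → OnHyperplane c v → Conflict u v → u ≗ v
onHyperplane-conflict⇒≗ c {n} {u = u} {v} 2≤∣c∣ rough u∈H v∈H (k , (x , x≢0) , v-u≡kx) t =
  toℕ-cancel-≈mod (≈mod-sym (-≈0⇒≈ (begin
    coords v t ℤ.- coords u t ≈⟨ conflict t ⟩
    k ℤ.* stepℤ (x t)         ≈⟨ ≈mod-*ʳ (stepℤ (x t)) k≈0 ⟩
    0ℤ ℤ.* stepℤ (x t)        ≡⟨ ℤ.*-zeroˡ (stepℤ (x t)) ⟩
    0ℤ                        ∎)))
  where
  open SetoidReasoning (≈mod-setoid n)
  conflict : ∀ t → coords v t ℤ.- coords u t ≈ k ℤ.* stepℤ (x t) ⟨mod n ⟩
  conflict t = ≡mod⇒≈ (v-u≡kx t)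
  H : ℤ
  H = horner c (stepℤ ∘ x)
  kH≈0 : k ℤ.* H ≈ 0ℤ ⟨mod n ⟩
  kH≈0 = begin
    k ℤ.* H                                     ≡⟨ horner-* c k (stepℤ ∘ x) ⟨
    horner c (λ t → k ℤ.* stepℤ (x t))          ≈⟨ horner-cong c (≈mod-sym ∘ conflict) ⟩
    horner c (λ t → coords v t ℤ.- coords u t)  ≡⟨ horner-- c (coords v) (coords u) ⟩
    horner c (coords v) ℤ.- horner c (coords u) ≈⟨ ≈mod-- v∈H u∈H ⟩
    0ℤ                                          ∎
  0<∣H∣ : 0 < ∣ H ∣
  0<∣H∣ = n≢0⇒n>0 (x≢0 ∘ horner-steps-≡0 2≤∣c∣ x ∘ ℤ.∣i∣≡0⇒i≡0)
  k≈0 : k ≈ 0ℤ ⟨mod n ⟩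
  k≈0 = rough-*≈0⇒≈0 rough 0<∣H∣ (horner-steps-< 2≤∣c∣ x) kH≈0

queen : ∀ {n m} .{{_ : NonZero n}} → ℤ → (Fin m → Fin n) → Field n (suc m)
queen {n} c a zero    = residue n (ℤ.- (c ℤ.* horner c (coords a)))
queen     c a (suc t) = a t

queen-onHyperplane : ∀ {n m} .{{_ : NonZero n}} c (a : Fin m → Fin n) → OnHyperplane c (queen c a)
queen-onHyperplane {n} c a = begin
  coords (queen c a) zero ℤ.+ cE ≈⟨ ≈mod-+ (residue-≈mod n (ℤ.- cE)) (≈mod-refl) ⟩
  ℤ.- cE ℤ.+ cE                  ≡⟨ ℤ.+-inverseˡ cE ⟩
  0ℤ                             ∎
  where
  open SetoidReasoning (≈mod-setoid n)
  cE = c ℤ.* horner c (coords a)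

theorem3 : (d n : ℕ) → 1 ≤ d → 1 ≤ n → NoPrimeDivisorBelow (2 ^ d) n →
    Σ (Fin (n ^ (d ∸ 1)) → Field n d) NonAttacking
theorem3 (suc m) n@(suc _) _ _ noSmallPrimes = queens , distinct , nonConflicting
  where
  queens : Fin (n ^ m) → Field n (suc m)
  queens = queen (+ 2) ∘ finToFun
  queens-onHyperplane : ∀ i → OnHyperplane (+ 2) (queens i)
  queens-onHyperplane i = queen-onHyperplane (+ 2) (finToFun {n} {m} i)
  queens-≗⇒≡ : ∀ {i j} → queens i ≗ queens j → i ≡ j
  queens-≗⇒≡ eq = finToFun-injective (eq ∘ suc)
  distinct : ∀ i j → i ≢ j → queens i ≢ queens j
  distinct i j i≢j = i≢j ∘ queens-≗⇒≡ ∘ cong-app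
  nonConflicting : ∀ i j → i ≢ j → ¬ Conflict (queens i) (queens j)
  nonConflicting i j i≢j = i≢j ∘ queens-≗⇒≡ ∘
    onHyperplane-conflict⇒≗ (+ 2) (s≤s (s≤s z≤n)) (noPrimeDivisorBelow⇒rough noSmallPrimes)
      (queens-onHyperplane i) (queens-onHyperplane j)
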